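{- Let $m,n,s,k$ be integers with $4\leq s\leq n$, $4\leq k\leq m$, $ms=nk$ and $s\equiv k\equiv 0\pmod 4$. Then there exists an integer $\mathcal{H}_t(m,n;s,k)$ for any divisor $t$ of $2ms$ such that $t\equiv 0\pmod 8$.
   Context: A partially filled (p.f.) array is an array in which some cells are filled and the others are empty. Let $v=2ms+t$ where $t$ divides $2ms$, and let $J$ be the subgroup of order $t$ of $\mathbb{Z}_v$. A Heffter array $\mathcal{H}_t(m,n;s,k)$ over $\mathbb{Z}_v$ relative to $J$ is an $m\times n$ p.f. array with elements in $\mathbb{Z}_v$ such that: (a) each row contains exactly $s$ filled cells and each column exactly $k$ filled cells; (b) for every $x\in\mathbb{Z}_v\setminus J$, either $x$ or $-x$ appears in the array; (c) the elements in every row and column sum to $0$. It is integer if the elements of every row and every column, viewed as integers in $\pm\{1,\ldots,\lfloor v/2\rfloor\}$, sum to $0$ in $\mathbb{Z}$. -}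

module Defs where

open import Data.Nat as ℕ using (ℕ; _<_)
open import Data.Nat.Divisibility as ℕD using ()
open import Data.Integer as ℤ using (ℤ; +_; ∣_∣)
open import Data.Integer.Divisibility as ℤD using ()
open import Data.Fin using (Fin)
open import Data.List using (List; map; allFin; foldr)
open import Data.Nat.ListAction using (sum)
open import Data.Maybe using (Maybe; just; nothing)
open import Data.Product using (Σ; _×_; ∃; ∃-syntax; _,_)
open import Data.Sum using (_⊎_)
open import Relation.Binary.PropositionalEquality using (_≡_)
open import Relation.Nullary using (¬_)

-- A partially filled m × n array with integer entries; nothing = empty cell.
PFArray : ℕ → ℕ → Set
PFArray m n = Fin m → Fin n → Maybe ℤ

filled : Maybe ℤ → ℕ
filled (just _) = 1
filled nothing  = 0

value : Maybe ℤ → ℤ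
value (just x) = x
value nothing  = + 0

rowCount : ∀ {m n} → PFArray m n → Fin m → ℕ
rowCount {n = n} A i = sum (map (λ j → filled (A i j)) (allFin n))

colCount : ∀ {m n} → PFArray m n → Fin n → ℕ
colCount {m = m} A j = sum (map (λ i → filled (A i j)) (allFin m))

sumℤ : List ℤ → ℤ
sumℤ = foldr ℤ._+_ (+ 0)

rowSum : ∀ {m n} → PFArray m n → Fin m → ℤ
rowSum {n = n} A i = sumℤ (map (λ j → value (A i j)) (allFin n))

colSum : ∀ {m n} → PFArray m n → Fin n → ℤ
colSum {m = m} A j = sumℤ (map (λ i → value (A i j)) (allFin m))

_≡_[mod_] : ℤ → ℤ → ℕ → Set
x ≡ y [mod v ] = (+ v) ℤD.∣ (x ℤ.- y)

-- the residue x ∈ ℤ_v (0 ≤ x < v) lies in J, the subgroup of order t of ℤ_v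
-- (t ∣ v): J = {x : t·x ≡ 0 mod v}  (= the multiples of v/t)
InJ : (v t x : ℕ) → Set
InJ v t x = v ℕD.∣ (t ℕ.* x)

AppearsPM : ∀ {m n} → (v : ℕ) → PFArray m n → ℕ → Set
AppearsPM {m} {n} v A x =
  ∃[ i ] ∃[ j ] ∃[ e ] (A i j ≡ just e × (e ≡ + x [mod v ] ⊎ e ≡ ℤ.- (+ x) [mod v ]))

-- Integer Heffter array H_t(m,n;s,k) over ℤ_v, v = 2ms + t, relative to J.
-- Entries of ℤ_v are represented by integers in ±{1,…,⌊v/2⌋}.
record IntegerHeffter (m n s k t : ℕ) (A : PFArray m n) : Set where
  v : ℕ
  v = 2 ℕ.* m ℕ.* s ℕ.+ t
  field
    entriesRep : ∀ i j e → A i j ≡ just e → 1 ℕ.≤ ∣ e ∣ × ∣ e ∣ ℕ.≤ v ℕ./ 2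
    rowFill    : ∀ i → rowCount A i ≡ s
    colFill    : ∀ j → colCount A j ≡ k
    covers     : ∀ x → x < v → ¬ InJ v t x → AppearsPM v A x
    rowSum≡0modv : ∀ i → rowSum A i ≡ + 0 [mod v ]
    colSum≡0modv : ∀ j → colSum A j ≡ + 0 [mod v ]
    rowSumInt≡0  : ∀ i → rowSum A i ≡ + 0
    colSumInt≡0  : ∀ j → colSum A j ≡ + 0

-- Let g = gcd s k = 4D, s = g s′ and k = g k′. As s′ and k′ are coprime, m s = n k gives
-- m = q k′ and n = q s′ with g ≤ q. Write t = 8T and 2ms = Rt; then v = 8Δ with Δ = T (R + 1),
-- and J consists of the multiples of R + 1.
-- View the array as a q × q grid of k′ × s′ blocks and fill block (I, K) iff its cyclic diagonal
-- δ = K − I mod q is below g; then each row has g s′ = s and each column g k′ = k filled cells.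
-- Diagonals come in groups δ = 4u + a, a < 4. Cell (r, c) of block row I on diagonal 4u + a holds
-- ±(a Δ + ℓ) with signs +, −, −, + for a = 0, 1, 2, 3, where the label 0 < ℓ < Δ, not divisible
-- by R + 1, is determined by (u, r, c) and a source block row: I for a ∈ {0, 1} and I + 2 for
-- a ∈ {2, 3}. Along a row the four cells of a group read ℓ, −(Δ + ℓ), −(2Δ + ℓ′), 3Δ + ℓ′ and
-- cancel. Going down a column the block row drops by one with each diagonal, so there diagonals
-- 4u + 2 and 4u + 3 have the sources of 4u and 4u + 1: the labels come as ℓ, ℓ′, ℓ, ℓ′ and the
-- cells cancel again.
-- The labels run through all such ℓ, so the magnitudes a Δ + ℓ are all integers in [1, v / 2)
-- not divisible by R + 1, which up to sign represent every residue outside J.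

module Submission where

open import Defs
open import Data.Nat using (ℕ; _≤_; _*_)
open import Data.Nat.Divisibility using (_∣_)
open import Data.Product using (∃)
open import Relation.Binary.PropositionalEquality using (_≡_)

open import Data.Nat as ℕ using (zero; suc; _+_; _∸_; _<_; _<?_; NonZero; _/_; _%_; z≤n; s≤s)
import Data.Nat.Properties as ℕ
open import Data.Nat.DivMod
open import Data.Nat.Divisibility using (divides; _∣0; ∣-refl; m%n≡0⇒n∣m; ∣m+n∣m⇒∣n; ∣m∣n⇒∣m+n)
open import Data.Nat.GCD
  using (gcd; gcd-greatest; gcd[m,n]∣m; gcd[m,n]∣n; gcd[m,n]≡0⇒m≡0; m/gcd[m,n]≢0; n/gcd[m,n]≢0)
open import Data.Nat.Coprimality as Coprime using (Coprime; coprime-/gcd; coprime-divisor)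
open import Data.Integer as ℤ using (ℤ; +_; -_)
import Data.Integer.Properties as ℤ
open import Data.Integer.Tactic.RingSolver using (solve-∀)
open import Data.Nat.Tactic.RingSolver using () renaming (solve-∀ to ℕ-solve-∀)
open import Data.Sum using (_⊎_; inj₁; inj₂)
open import Data.Product using (_×_; _,_; ∃-syntax; proj₁; proj₂; map₂)
open import Data.Maybe using (Maybe; just; nothing)
open import Relation.Nullary using (¬_; yes; no; contradiction)
open import Data.Fin using (toℕ; fromℕ<)
open import Data.Fin.Properties using (toℕ<n; toℕ-fromℕ<)
open import Data.List using ([]; _∷_; map; allFin; tabulate)
open import Data.Nat.ListAction using (sum)
open import Data.List.Properties using (map-tabulate)
open import Function using (_∘_)
open import Relation.Binary.Definitions using (tri<; tri≈; tri>)
open import Relation.Binary.PropositionalEquality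
  using (refl; sym; trans; cong; cong₂; subst; subst₂; module ≡-Reasoning)

sumBelow : ℕ → (ℕ → ℤ) → ℤ
sumBelow zero    f = + 0
sumBelow (suc n) f = f 0 ℤ.+ sumBelow n (f ∘ suc)

sumBelow-cong : ∀ n {f g : ℕ → ℤ} → (∀ i → i < n → f i ≡ g i) → sumBelow n f ≡ sumBelow n g
sumBelow-cong zero    f≡g = refl
sumBelow-cong (suc n) f≡g =
  cong₂ ℤ._+_ (f≡g 0 (s≤s z≤n)) (sumBelow-cong n (λ i i<n → f≡g (suc i) (s≤s i<n)))

sumBelow-const : ∀ n a → sumBelow n (λ _ → + a) ≡ + (n * a)
sumBelow-const zero    a = refl
sumBelow-const (suc n) a = trans (cong (λ w → + a ℤ.+ w) (sumBelow-const n a)) (sym (ℤ.pos-+ a (n * a)))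

sumBelow-zero : ∀ n (f : ℕ → ℤ) → (∀ i → i < n → f i ≡ + 0) → sumBelow n f ≡ + 0
sumBelow-zero n f f≡0 =
  trans (sumBelow-cong n f≡0) (trans (sumBelow-const n 0) (cong +_ (ℕ.*-zeroʳ n)))

sumBelow-+ : ∀ n (f g : ℕ → ℤ) → sumBelow n (λ i → f i ℤ.+ g i) ≡ sumBelow n f ℤ.+ sumBelow n g
sumBelow-+ zero    f g = refl
sumBelow-+ (suc n) f g = trans (cong (λ w → f 0 ℤ.+ g 0 ℤ.+ w) (sumBelow-+ n (f ∘ suc) (g ∘ suc)))
                               (interchange (f 0) (g 0) _ _)
  where
  interchange : ∀ a b c d → a ℤ.+ b ℤ.+ (c ℤ.+ d) ≡ a ℤ.+ c ℤ.+ (b ℤ.+ d)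
  interchange = solve-∀

sumBelow-swap : ∀ a b (f : ℕ → ℕ → ℤ) →
  sumBelow a (λ i → sumBelow b (f i)) ≡ sumBelow b (λ j → sumBelow a (λ i → f i j))
sumBelow-swap zero    b f = sym (sumBelow-zero b _ (λ _ _ → refl))
sumBelow-swap (suc a) b f = trans (cong (λ w → sumBelow b (f 0) ℤ.+ w) (sumBelow-swap a b (f ∘ suc)))
                                  (sym (sumBelow-+ b (f 0) _))

sumBelow-split : ∀ a b (f : ℕ → ℤ) → sumBelow (a + b) f ≡ sumBelow a f ℤ.+ sumBelow b (λ i → f (a + i))
sumBelow-split zero    b f = sym (ℤ.+-identityˡ _)
sumBelow-split (suc a) b f =
  trans (cong (λ w → f 0 ℤ.+ w) (sumBelow-split a b (f ∘ suc))) (sym (ℤ.+-assoc (f 0) _ _))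

sumBelow-* : ∀ q k (f : ℕ → ℤ) → sumBelow (q * k) f ≡ sumBelow q (λ I → sumBelow k (λ r → f (I * k + r)))
sumBelow-* zero    k f = refl
sumBelow-* (suc q) k f =
  trans (sumBelow-split k (q * k) f)
        (cong (λ w → sumBelow k f ℤ.+ w)
          (trans (sumBelow-* q k (λ i → f (k + i)))
                 (sumBelow-cong q (λ I _ → sumBelow-cong k (λ r _ → cong f (sym (ℕ.+-assoc k (I * k) r)))))))

sumBelow-truncate : ∀ {d q} (f : ℕ → ℤ) → d ≤ q → (∀ i → d ≤ i → f i ≡ + 0) → sumBelow q f ≡ sumBelow d f
sumBelow-truncate {d} {q} f d≤q f≡0 = begin
  sumBelow q f
    ≡⟨ cong (λ n → sumBelow n f) (sym (ℕ.m+[n∸m]≡n d≤q)) ⟩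
  sumBelow (d + (q ∸ d)) f
    ≡⟨ sumBelow-split d (q ∸ d) f ⟩
  sumBelow d f ℤ.+ sumBelow (q ∸ d) (λ i → f (d + i))
    ≡⟨ cong (λ w → sumBelow d f ℤ.+ w) tail≡0 ⟩
  sumBelow d f ℤ.+ + 0
    ≡⟨ ℤ.+-identityʳ _ ⟩
  sumBelow d f ∎
  where
  open ≡-Reasoning
  tail≡0 : sumBelow (q ∸ d) (λ i → f (d + i)) ≡ + 0
  tail≡0 = sumBelow-zero (q ∸ d) _ (λ i _ → f≡0 (d + i) (ℕ.m≤m+n d i))

sumBelow-snoc : ∀ q (f : ℕ → ℤ) → sumBelow (suc q) f ≡ sumBelow q f ℤ.+ f q
sumBelow-snoc zero    f = ℤ.+-comm (f 0) (+ 0)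
sumBelow-snoc (suc q) f =
  trans (cong (λ w → f 0 ℤ.+ w) (sumBelow-snoc q (f ∘ suc))) (sym (ℤ.+-assoc (f 0) _ _))

sumBelow-reverse : ∀ q (f : ℕ → ℤ) → sumBelow q f ≡ sumBelow q (λ i → f (q ∸ suc i))
sumBelow-reverse zero    f = refl
sumBelow-reverse (suc q) f =
  trans (sumBelow-snoc q f)
        (trans (ℤ.+-comm (sumBelow q f) (f q)) (cong (λ w → f q ℤ.+ w) (sumBelow-reverse q f)))

sumBelow-rotate : ∀ q a .{{_ : NonZero q}} (f : ℕ → ℤ) → a ≤ q →
  sumBelow q (λ i → f ((i + a) % q)) ≡ sumBelow q f
sumBelow-rotate q a f a≤q = begin
  sumBelow q g
    ≡⟨ cong (λ n → sumBelow n g) q≡b+a ⟩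
  sumBelow (b + a) g
    ≡⟨ sumBelow-split b a g ⟩
  sumBelow b g ℤ.+ sumBelow a (λ i → g (b + i))
    ≡⟨ cong₂ ℤ._+_ (sumBelow-cong b head) (sumBelow-cong a tail) ⟩
  sumBelow b (λ i → f (i + a)) ℤ.+ sumBelow a f
    ≡⟨ ℤ.+-comm _ (sumBelow a f) ⟩
  sumBelow a f ℤ.+ sumBelow b (λ i → f (i + a))
    ≡⟨ cong (λ w → sumBelow a f ℤ.+ w) (sumBelow-cong b (λ i _ → cong f (ℕ.+-comm i a))) ⟩
  sumBelow a f ℤ.+ sumBelow b (λ i → f (a + i))
    ≡⟨ sym (sumBelow-split a b f) ⟩
  sumBelow (a + b) f
    ≡⟨ cong (λ n → sumBelow n f) (ℕ.m+[n∸m]≡n a≤q) ⟩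
  sumBelow q f ∎
  where
  open ≡-Reasoning
  g : ℕ → ℤ
  g i = f ((i + a) % q)
  b : ℕ
  b = q ∸ a
  q≡b+a : q ≡ b + a
  q≡b+a = sym (ℕ.m∸n+n≡m a≤q)
  head : ∀ i → i < b → g i ≡ f (i + a)
  head i i<b = cong f (m<n⇒m%n≡m (subst (i + a <_) (sym q≡b+a) (ℕ.+-monoˡ-< a i<b)))
  tail : ∀ i → i < a → g (b + i) ≡ f i
  tail i i<a = cong f (trans (cong (_% q) wrap) (trans ([m+n]%n≡m%n i q) (m<n⇒m%n≡m (ℕ.<-≤-trans i<a a≤q))))
    where
    wrap : b + i + a ≡ i + q
    wrap = trans (ℕ.+-assoc b i a) (trans (cong (_+_ b) (ℕ.+-comm i a))
             (trans (sym (ℕ.+-assoc b a i)) (trans (cong (_+ i) (sym q≡b+a)) (ℕ.+-comm q i))))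

sumℤ-allFin : ∀ n (g : ℕ → ℤ) → sumℤ (map (λ j → g (toℕ j)) (allFin n)) ≡ sumBelow n g
sumℤ-allFin n g = trans (cong sumℤ (map-tabulate {n = n} (λ j → j) (λ j → g (toℕ j)))) (tabulated n g)
  where
  tabulated : ∀ n (g : ℕ → ℤ) → sumℤ (tabulate {n = n} (λ j → g (toℕ j))) ≡ sumBelow n g
  tabulated zero    g = refl
  tabulated (suc n) g = cong (λ w → g 0 ℤ.+ w) (tabulated n (g ∘ suc))

[m*n+o]%n≡o : ∀ m n o .{{_ : NonZero n}} → o < n → (m * n + o) % n ≡ o
[m*n+o]%n≡o m n o o<n = trans (cong (_% n) (ℕ.+-comm (m * n) o)) (trans ([m+kn]%n≡m%n o m n) (m<n⇒m%n≡m o<n))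

[m*n+o]/n≡m : ∀ m n o .{{_ : NonZero n}} → o < n → (m * n + o) / n ≡ m
[m*n+o]/n≡m m n o o<n = trans (+-distrib-/-∣ˡ o (divides m refl))
  (trans (cong₂ _+_ (m*n/n≡m m n) (m<n⇒m/n≡0 o<n)) (ℕ.+-identityʳ m))

[m%n+o]%n≡[m+o]%n : ∀ m o n .{{_ : NonZero n}} → (m % n + o) % n ≡ (m + o) % n
[m%n+o]%n≡[m+o]%n m o n = trans (%-distribˡ-+ (m % n) o n)
  (trans (cong (λ w → (w + o % n) % n) (m%n%n≡m%n m n)) (sym (%-distribˡ-+ m o n)))

m*o+p<n*o : ∀ {m n o p} → m < n → p < o → m * o + p < n * o
m*o+p<n*o {m} {n} {o} {p} m<n p<o = ℕ.<-≤-trans (ℕ.+-monoʳ-< (m * o) p<o)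
  (subst (_≤ n * o) (ℕ.+-comm o (m * o)) (ℕ.*-monoˡ-≤ o m<n))

sumBelow-divMod : ∀ q s .{{_ : NonZero s}} (f : ℕ → ℕ → ℤ) →
  sumBelow (q * s) (λ y → f (y / s) (y % s)) ≡ sumBelow q (λ J → sumBelow s (f J))
sumBelow-divMod q s f = trans (sumBelow-* q s _)
  (sumBelow-cong q (λ J _ → sumBelow-cong s (λ c c<s →
    cong₂ f ([m*n+o]/n≡m J s c c<s) ([m*n+o]%n≡o J s c c<s))))

sumBelow-groups : ∀ D k n (h : ℕ → ℕ → ℤ) →
  (∀ u j → u < D → j < n → sumBelow k (λ a → h (u * k + a) j) ≡ + 0) →
  sumBelow (D * k) (λ δ → sumBelow n (h δ)) ≡ + 0
sumBelow-groups D k n h groups-cancel = trans (sumBelow-* D k _) (sumBelow-zero D _ (λ u u<D →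
  trans (sumBelow-swap k n (λ a → h (u * k + a))) (sumBelow-zero n _ (λ j → groups-cancel u j u<D))))

module Cyclic (q : ℕ) .{{_ : NonZero q}} where

  infixl 6 _⊖_
  _⊖_ : ℕ → ℕ → ℕ
  J ⊖ I = (J + (q ∸ I)) % q

  [I+δ]⊖I≡δ : ∀ I δ → I ≤ q → δ < q → (I + δ) % q ⊖ I ≡ δ
  [I+δ]⊖I≡δ I δ I≤q δ<q = trans ([m%n+o]%n≡[m+o]%n (I + δ) (q ∸ I) q)
    (trans (cong (_% q) wrap) (trans ([m+n]%n≡m%n δ q) (m<n⇒m%n≡m δ<q)))
    where
    wrap : I + δ + (q ∸ I) ≡ δ + q
    wrap = trans (cong (_+ (q ∸ I)) (ℕ.+-comm I δ))
                 (trans (ℕ.+-assoc δ I (q ∸ I)) (cong (_+_ δ) (ℕ.m+[n∸m]≡n I≤q)))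

  [J⊖δ+δ]%q≡J : ∀ J δ → J < q → δ ≤ q → (J ⊖ δ + δ) % q ≡ J
  [J⊖δ+δ]%q≡J J δ J<q δ≤q = trans ([m%n+o]%n≡[m+o]%n (J + (q ∸ δ)) δ q)
    (trans (cong (_% q) wrap) (trans ([m+n]%n≡m%n J q) (m<n⇒m%n≡m J<q)))
    where
    wrap : J + (q ∸ δ) + δ ≡ J + q
    wrap = trans (ℕ.+-assoc J (q ∸ δ) δ) (cong (_+_ J) (ℕ.m∸n+n≡m δ≤q))

  J⊖[J⊖δ]≡δ : ∀ J δ → J < q → δ < q → J ⊖ (J ⊖ δ) ≡ δ
  J⊖[J⊖δ]≡δ J δ J<q δ<q = trans (cong (_⊖ (J ⊖ δ)) (sym ([J⊖δ+δ]%q≡J J δ J<q (ℕ.<⇒≤ δ<q))))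
                                ([I+δ]⊖I≡δ (J ⊖ δ) δ (ℕ.<⇒≤ (m%n<n (J + (q ∸ δ)) q)) δ<q)

  [J⊖[x+a+2]+2]%q≡J⊖[x+a] : ∀ J x a → x + (a + 2) ≤ q → (J ⊖ (x + (a + 2)) + 2) % q ≡ J ⊖ (x + a)
  [J⊖[x+a+2]+2]%q≡J⊖[x+a] J x a bound =
    trans ([m%n+o]%n≡[m+o]%n (J + (q ∸ (x + (a + 2)))) 2 q) (cong (_% q) shift)
    where
    open ≡-Reasoning
    shift : J + (q ∸ (x + (a + 2))) + 2 ≡ J + (q ∸ (x + a))
    shift = begin
      J + (q ∸ (x + (a + 2))) + 2   ≡⟨ ℕ.+-assoc J _ 2 ⟩
      J + (q ∸ (x + (a + 2)) + 2)   ≡⟨ cong (λ w → J + (q ∸ w + 2)) (sym (ℕ.+-assoc x a 2)) ⟩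
      J + (q ∸ (x + a + 2) + 2)     ≡⟨ cong (λ w → J + (w + 2)) (sym (ℕ.∸-+-assoc q (x + a) 2)) ⟩
      J + (q ∸ (x + a) ∸ 2 + 2)     ≡⟨ cong (_+_ J) (ℕ.m∸n+n≡m (ℕ.m+n≤o⇒m≤o∸n 2 two+x+a≤q)) ⟩
      J + (q ∸ (x + a))             ∎
      where
      two+x+a≤q : 2 + (x + a) ≤ q
      two+x+a≤q = subst (_≤ q) (trans (sym (ℕ.+-assoc x a 2)) (ℕ.+-comm (x + a) 2)) bound

  sumBelow-⊖ʳ : ∀ I (f : ℕ → ℤ) → sumBelow q (λ J → f (J ⊖ I)) ≡ sumBelow q f
  sumBelow-⊖ʳ I f = sumBelow-rotate q (q ∸ I) f (ℕ.m∸n≤m q I)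

  sumBelow-⊖ˡ : ∀ J (f : ℕ → ℤ) → J < q → sumBelow q (λ δ → f (J ⊖ δ)) ≡ sumBelow q f
  sumBelow-⊖ˡ J f J<q = begin
    sumBelow q (λ δ → f (J ⊖ δ))               ≡⟨ sumBelow-reverse q _ ⟩
    sumBelow q (λ i → f (J ⊖ (q ∸ suc i)))     ≡⟨ sumBelow-cong q (λ i i<q → cong f (reflect i i<q)) ⟩
    sumBelow q (λ i → f ((i + suc J) % q))     ≡⟨ sumBelow-rotate q (suc J) f J<q ⟩
    sumBelow q f                               ∎
    where
    open ≡-Reasoning
    reflect : ∀ i → i < q → J ⊖ (q ∸ suc i) ≡ (i + suc J) % q
    reflect i i<q = cong (_% q) (trans (cong (_+_ J) (ℕ.m∸[m∸n]≡n i<q))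
                                       (trans (ℕ.+-comm J (suc i)) (sym (ℕ.+-suc i J))))

  sumBelow-circulantRow : ∀ s .{{_ : NonZero s}} I (F : ℕ → ℕ → ℤ) →
    sumBelow (q * s) (λ y → F (y / s ⊖ I) (y % s)) ≡ sumBelow q (λ δ → sumBelow s (F δ))
  sumBelow-circulantRow s I F = trans (sumBelow-divMod q s (λ J → F (J ⊖ I)))
                                      (sumBelow-⊖ʳ I (λ δ → sumBelow s (F δ)))

  sumBelow-circulantColumn : ∀ k .{{_ : NonZero k}} J (F : ℕ → ℕ → ℕ → ℤ) → J < q →
    sumBelow (q * k) (λ x → F (x / k) (x % k) (J ⊖ x / k)) ≡
    sumBelow q (λ δ → sumBelow k (λ r → F (J ⊖ δ) r δ))
  sumBelow-circulantColumn k J F J<q = begin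
    sumBelow (q * k) (λ x → F (x / k) (x % k) (J ⊖ x / k))
      ≡⟨ sumBelow-divMod q k (λ I r → F I r (J ⊖ I)) ⟩
    sumBelow q G
      ≡⟨ sym (sumBelow-⊖ˡ J G J<q) ⟩
    sumBelow q (λ δ → G (J ⊖ δ))
      ≡⟨ sumBelow-cong q (λ δ δ<q → sumBelow-cong k (λ r _ →
          cong (F (J ⊖ δ) r) (J⊖[J⊖δ]≡δ J δ J<q δ<q))) ⟩
    sumBelow q (λ δ → sumBelow k (λ r → F (J ⊖ δ) r δ)) ∎
    where
    open ≡-Reasoning
    G : ℕ → ℤ
    G I = sumBelow k (λ r → F I r (J ⊖ I))

sign : ℕ → ℤ → ℤ
sign 0 x = x
sign 1 x = - x
sign 2 x = - x
sign _ x = x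

sign-± : ∀ a x → sign a x ≡ x ⊎ sign a x ≡ - x
sign-± 0 x                   = inj₁ refl
sign-± 1 x                   = inj₂ refl
sign-± 2 x                   = inj₂ refl
sign-± (suc (suc (suc _))) x = inj₁ refl

∣sign∣ : ∀ a x → ℤ.∣ sign a x ∣ ≡ ℤ.∣ x ∣
∣sign∣ a x with sign-± a x
... | inj₁ eq = cong ℤ.∣_∣ eq
... | inj₂ eq = trans (cong ℤ.∣_∣ eq) (ℤ.∣-i∣≡∣i∣ x)

sumBelow-signedQuadruple : ∀ Δ (f : ℕ → ℕ) → f 0 + f 3 ≡ f 1 + f 2 →
  sumBelow 4 (λ a → sign a (+ (a * Δ + f a))) ≡ + 0
sumBelow-signedQuadruple Δ f balanced = begin
  + a ℤ.+ (- + b ℤ.+ (- + c ℤ.+ (+ d ℤ.+ + 0)))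
    ≡⟨ regroup (+ a) (+ b) (+ c) (+ d) ⟩
  (+ a ℤ.+ + d) ℤ.- (+ b ℤ.+ + c)
    ≡⟨ cong₂ ℤ._-_ (sym (ℤ.pos-+ a d)) (sym (ℤ.pos-+ b c)) ⟩
  + (a + d) ℤ.- + (b + c)
    ≡⟨ cong (λ w → + w ℤ.- + (b + c)) a+d≡b+c ⟩
  + (b + c) ℤ.- + (b + c)
    ≡⟨ ℤ.+-inverseʳ (+ (b + c)) ⟩
  + 0 ∎
  where
  open ≡-Reasoning
  a b c d : ℕ
  a = 0 * Δ + f 0
  b = 1 * Δ + f 1
  c = 2 * Δ + f 2
  d = 3 * Δ + f 3
  regroup : ∀ a b c d → a ℤ.+ (- b ℤ.+ (- c ℤ.+ (d ℤ.+ + 0))) ≡ (a ℤ.+ d) ℤ.- (b ℤ.+ c)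
  regroup = solve-∀
  outer : ∀ Δ x y → 0 * Δ + x + (3 * Δ + y) ≡ 3 * Δ + (x + y)
  outer = ℕ-solve-∀
  inner : ∀ Δ x y → 1 * Δ + x + (2 * Δ + y) ≡ 3 * Δ + (x + y)
  inner = ℕ-solve-∀
  a+d≡b+c : a + d ≡ b + c
  a+d≡b+c = trans (outer Δ (f 0) (f 3)) (trans (cong (_+_ (3 * Δ)) balanced) (sym (inner Δ (f 1) (f 2))))

≡[mod]-refl : ∀ v z → z ≡ z [mod v ]
≡[mod]-refl v z = subst (λ w → v ∣ ℤ.∣ w ∣) (sym (ℤ.+-inverseʳ z)) (v ∣0)

≡[mod]-neg : ∀ {v a b} → a ≡ b [mod v ] → (- a) ≡ - b [mod v ]
≡[mod]-neg {v} {a} {b} v∣a-b =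
  subst (λ w → v ∣ ℤ.∣ w ∣) (negate a b) (subst (λ n → v ∣ n) (sym (ℤ.∣-i∣≡∣i∣ (a ℤ.- b))) v∣a-b)
  where
  negate : ∀ a b → - (a ℤ.- b) ≡ - a ℤ.- - b
  negate = solve-∀

v∸x≡-x[mod] : ∀ {v x} → x ≤ v → (+ (v ∸ x)) ≡ - (+ x) [mod v ]
v∸x≡-x[mod] {v} {x} x≤v = subst (λ w → v ∣ ℤ.∣ w ∣) (sym difference) (∣-refl {v})
  where
  difference : + (v ∸ x) ℤ.- - + x ≡ + v
  difference = trans (cong (λ w → + (v ∸ x) ℤ.+ w) (ℤ.neg-involutive (+ x)))
                     (trans (sym (ℤ.pos-+ (v ∸ x) x)) (cong +_ (ℕ.m∸n+n≡m x≤v)))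

±≡±[mod] : ∀ {v e y x} → e ≡ + y ⊎ e ≡ - + y → (+ y) ≡ + x [mod v ] ⊎ (+ y) ≡ - (+ x) [mod v ] →
           e ≡ + x [mod v ] ⊎ e ≡ - (+ x) [mod v ]
±≡±[mod] (inj₁ refl) y≡±x = y≡±x
±≡±[mod] {y = y} {x} (inj₂ refl) (inj₁ y≡x)  = inj₂ (≡[mod]-neg {a = + y} {+ x} y≡x)
±≡±[mod] {v} {y = y} {x} (inj₂ refl) (inj₂ y≡-x) =
  inj₁ (subst (λ w → (- (+ y)) ≡ w [mod v ]) (ℤ.neg-involutive (+ x)) (≡[mod]-neg {a = + y} { - (+ x)} y≡-x))

+sum≡sumℤ : ∀ {A : Set} (f : A → ℕ) xs → + sum (map f xs) ≡ sumℤ (map (λ x → + f x) xs)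
+sum≡sumℤ f []       = refl
+sum≡sumℤ f (x ∷ xs) = trans (ℤ.pos-+ (f x) _) (cong (λ w → + f x ℤ.+ w) (+sum≡sumℤ f xs))

sumBelow-ones : ∀ a b → sumBelow a (λ _ → sumBelow b (λ _ → + 1)) ≡ + (a * b)
sumBelow-ones a b = trans (sumBelow-cong a (λ _ _ → sumBelow-const b 1))
                          (trans (sumBelow-const a (b * 1)) (cong (λ n → + (a * n)) (ℕ.*-identityʳ b)))

module Construction (q k′ s′ D T R : ℕ)
  .{{_ : NonZero k′}} .{{_ : NonZero s′}} .{{_ : NonZero D}} .{{_ : NonZero T}} .{{_ : NonZero R}}
  (4D≤q : D * 4 ≤ q) (qDk′s′≡TR : q * D * k′ * s′ ≡ T * R) where

  4≤q : 4 ≤ q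
  4≤q = ℕ.≤-trans (ℕ.*-monoˡ-≤ 4 (ℕ.>-nonZero⁻¹ D)) 4D≤q

  private instance
    q-nonZero : NonZero q
    q-nonZero = ℕ.>-nonZero (ℕ.<-≤-trans (s≤s z≤n) 4≤q)

  open Cyclic q

  -- g = gcd s k, R₁ = v / t and H = v / 2.
  g R₁ Δ H : ℕ
  g  = D * 4
  R₁ = suc R
  Δ  = T * R₁
  H  = 4 * Δ

  -- counted from z = 0
  nthNonMultiple : ℕ → ℕ
  nthNonMultiple z = z / R * R₁ + suc (z % R)

  source : ℕ → ℕ → ℕ
  source I 0 = I
  source I 1 = I
  source I _ = (I + 2) % q

  labelIndex : ℕ → ℕ → ℕ → ℕ → ℕ
  labelIndex π u r c = ((π * D + u) * k′ + r) * s′ + c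

  quadEntry : ℕ → ℕ → ℕ → ℕ → ℕ → ℤ
  quadEntry I r u a c = sign a (+ (a * Δ + nthNonMultiple (labelIndex (source I a) u r c)))

  entry : ℕ → ℕ → ℕ → ℕ → ℤ
  entry I r δ c = quadEntry I r (δ / 4) (δ % 4) c

  block : ℕ → ℕ → ℕ → ℕ → Maybe ℤ
  block I r δ c with δ <? g
  ... | yes _ = just (entry I r δ c)
  ... | no  _ = nothing

  cell : ℕ → ℕ → Maybe ℤ
  cell x y = block (x / k′) (x % k′) (y / s′ ⊖ x / k′) (y % s′)

  block-filled : ∀ {I r δ c} → δ < g → block I r δ c ≡ just (entry I r δ c)
  block-filled {δ = δ} δ<g with δ <? g
  ... | yes _   = refl
  ... | no  δ≮g = contradiction δ<g δ≮g

  block-empty : ∀ {I r δ c} → g ≤ δ → block I r δ c ≡ nothing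
  block-empty {δ = δ} g≤δ with δ <? g
  ... | yes δ<g = contradiction g≤δ (ℕ.<⇒≱ δ<g)
  ... | no  _   = refl

  block-just : ∀ {I r δ c e} → block I r δ c ≡ just e → δ < g × entry I r δ c ≡ e
  block-just {δ = δ} eq with δ <? g
  block-just refl | yes δ<g = δ<g , refl
  block-just ()   | no  _

  entry-quad : ∀ I r u a c → a < 4 → entry I r (u * 4 + a) c ≡ quadEntry I r u a c
  entry-quad I r u a c a<4 =
    cong₂ (λ u′ a′ → quadEntry I r u′ a′ c) ([m*n+o]/n≡m u 4 a a<4) ([m*n+o]%n≡o u 4 a a<4)

  sumBelow-row : ∀ (φ : Maybe ℤ → ℤ) → φ nothing ≡ + 0 → ∀ x →
    sumBelow (q * s′) (λ y → φ (cell x y)) ≡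
    sumBelow g (λ δ → sumBelow s′ (λ c → φ (just (entry (x / k′) (x % k′) δ c))))
  sumBelow-row φ φ-empty x = begin
    sumBelow (q * s′) (λ y → φ (cell x y))
      ≡⟨ sumBelow-circulantRow s′ I (λ δ c → φ (block I r δ c)) ⟩
    sumBelow q (λ δ → sumBelow s′ (λ c → φ (block I r δ c)))
      ≡⟨ sumBelow-truncate _ 4D≤q (λ δ g≤δ →
          sumBelow-zero s′ _ (λ c _ → trans (cong φ (block-empty g≤δ)) φ-empty)) ⟩
    sumBelow g (λ δ → sumBelow s′ (λ c → φ (block I r δ c)))
      ≡⟨ sumBelow-cong g (λ δ δ<g →
          sumBelow-cong s′ (λ c _ → cong φ (block-filled δ<g))) ⟩
    sumBelow g (λ δ → sumBelow s′ (λ c → φ (just (entry I r δ c)))) ∎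
    where
    open ≡-Reasoning
    I r : ℕ
    I = x / k′
    r = x % k′

  sumBelow-column : ∀ (φ : Maybe ℤ → ℤ) → φ nothing ≡ + 0 → ∀ y → y < q * s′ →
    sumBelow (q * k′) (λ x → φ (cell x y)) ≡
    sumBelow g (λ δ → sumBelow k′ (λ r → φ (just (entry (y / s′ ⊖ δ) r δ (y % s′)))))
  sumBelow-column φ φ-empty y y<qs′ = begin
    sumBelow (q * k′) (λ x → φ (cell x y))
      ≡⟨ sumBelow-circulantColumn k′ J (λ I r δ → φ (block I r δ c)) J<q ⟩
    sumBelow q (λ δ → sumBelow k′ (λ r → φ (block (J ⊖ δ) r δ c)))
      ≡⟨ sumBelow-truncate _ 4D≤q (λ δ g≤δ →
          sumBelow-zero k′ _ (λ r _ → trans (cong φ (block-empty g≤δ)) φ-empty)) ⟩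
    sumBelow g (λ δ → sumBelow k′ (λ r → φ (block (J ⊖ δ) r δ c)))
      ≡⟨ sumBelow-cong g (λ δ δ<g →
          sumBelow-cong k′ (λ r _ → cong φ (block-filled δ<g))) ⟩
    sumBelow g (λ δ → sumBelow k′ (λ r → φ (just (entry (J ⊖ δ) r δ c)))) ∎
    where
    open ≡-Reasoning
    J c : ℕ
    J = y / s′
    c = y % s′
    J<q : J < q
    J<q = m<n*o⇒m/o<n y<qs′

  diagonalGroup-cancels : ∀ u r c (I : ℕ → ℕ) →
    let f a = nthNonMultiple (labelIndex (source (I a) a) u r c) in f 0 + f 3 ≡ f 1 + f 2 →
    sumBelow 4 (λ a → entry (I a) r (u * 4 + a) c) ≡ + 0
  diagonalGroup-cancels u r c I balanced =
    trans (sumBelow-cong 4 (λ a a<4 → entry-quad (I a) r u a c a<4))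
          (sumBelow-signedQuadruple Δ (λ a → nthNonMultiple (labelIndex (source (I a) a) u r c)) balanced)

  column-balanced : ∀ J u r c → u < D →
    let f a = nthNonMultiple (labelIndex (source (J ⊖ (u * 4 + a)) a) u r c) in f 0 + f 3 ≡ f 1 + f 2
  column-balanced J u r c u<D = begin
    f 0 + f 3
      ≡⟨ cong (λ π → f 0 + nthNonMultiple (labelIndex π u r c)) (shift 1 (s≤s (s≤s (s≤s (s≤s z≤n))))) ⟩
    f 0 + f 1
      ≡⟨ ℕ.+-comm (f 0) (f 1) ⟩
    f 1 + f 0
      ≡⟨ cong (λ π → f 1 + nthNonMultiple (labelIndex π u r c)) (sym (shift 0 (s≤s (s≤s (s≤s z≤n))))) ⟩
    f 1 + f 2 ∎
    where
    open ≡-Reasoning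
    f : ℕ → ℕ
    f a = nthNonMultiple (labelIndex (source (J ⊖ (u * 4 + a)) a) u r c)
    shift : ∀ a → a + 2 < 4 → (J ⊖ (u * 4 + (a + 2)) + 2) % q ≡ J ⊖ (u * 4 + a)
    shift a a+2<4 = [J⊖[x+a+2]+2]%q≡J⊖[x+a] J (u * 4) a (ℕ.<⇒≤ (ℕ.<-≤-trans (m*o+p<n*o u<D a+2<4) 4D≤q))

  row-cancels : ∀ I r → sumBelow g (λ δ → sumBelow s′ (λ c → entry I r δ c)) ≡ + 0
  row-cancels I r = sumBelow-groups D 4 s′ (λ δ c → entry I r δ c)
    (λ u c _ _ → diagonalGroup-cancels u r c (λ _ → I) refl)

  column-cancels : ∀ J c → sumBelow g (λ δ → sumBelow k′ (λ r → entry (J ⊖ δ) r δ c)) ≡ + 0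
  column-cancels J c = sumBelow-groups D 4 k′ (λ δ r → entry (J ⊖ δ) r δ c)
    (λ u r u<D _ → diagonalGroup-cancels u r c (λ a → J ⊖ (u * 4 + a)) (column-balanced J u r c u<D))

  nthNonMultiple<Δ : ∀ {z} → z < T * R → nthNonMultiple z < Δ
  nthNonMultiple<Δ {z} z<TR = m*o+p<n*o {n = T} (m<n*o⇒m/o<n z<TR) (s≤s (m%n<n z R))

  0<nthNonMultiple : ∀ z → 0 < nthNonMultiple z
  0<nthNonMultiple z = ℕ.≤-trans (s≤s z≤n) (ℕ.m≤n+m (suc (z % R)) (z / R * R₁))

  labelIndex<TR : ∀ {π u r c} → π < q → u < D → r < k′ → c < s′ → labelIndex π u r c < T * R
  labelIndex<TR {π} {u} {r} {c} π<q u<D r<k′ c<s′ =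
    subst (labelIndex π u r c <_) qDk′s′≡TR (m*o+p<n*o (m*o+p<n*o (m*o+p<n*o π<q u<D) r<k′) c<s′)

  source<q : ∀ I a → I < q → source I a < q
  source<q I 0                   I<q = I<q
  source<q I 1                   I<q = I<q
  source<q I (suc (suc _))       I<q = m%n<n (I + 2) q

  entry-bounds : ∀ {I r δ c} → I < q → r < k′ → δ < g → c < s′ →
    1 ≤ ℤ.∣ entry I r δ c ∣ × ℤ.∣ entry I r δ c ∣ < H
  entry-bounds {I} {r} {δ} {c} I<q r<k′ δ<g c<s′ =
    subst (λ n → 1 ≤ n × n < H) (sym (∣sign∣ a (+ (a * Δ + nthNonMultiple z))))
    (ℕ.≤-trans (0<nthNonMultiple z) (ℕ.m≤n+m (nthNonMultiple z) (a * Δ)) ,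
     m*o+p<n*o (m%n<n δ 4) (nthNonMultiple<Δ (labelIndex<TR (source<q I a I<q) (m<n*o⇒m/o<n δ<g) r<k′ c<s′)))
    where
    a z : ℕ
    a = δ % 4
    z = labelIndex (source I a) (δ / 4) r c

  cell-bounds : ∀ {x y e} → x < q * k′ → y < q * s′ → cell x y ≡ just e → 1 ≤ ℤ.∣ e ∣ × ℤ.∣ e ∣ < H
  cell-bounds {x} {y} x<qk′ y<qs′ eq with block-just eq
  ... | δ<g , refl = entry-bounds (m<n*o⇒m/o<n x<qk′) (m%n<n x k′) δ<g (m%n<n y s′)

  cell-at : ∀ {I r δ c} → I < q → r < k′ → δ < q → c < s′ →
    cell (I * k′ + r) ((I + δ) % q * s′ + c) ≡ block I r δ c
  cell-at {I} {r} {δ} {c} I<q r<k′ δ<q c<s′ = begin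
    cell (I * k′ + r) (J * s′ + c)
      ≡⟨ cong₂ (λ I′ r′ → block I′ r′ ((J * s′ + c) / s′ ⊖ I′) ((J * s′ + c) % s′))
          ([m*n+o]/n≡m I k′ r r<k′) ([m*n+o]%n≡o I k′ r r<k′) ⟩
    block I r ((J * s′ + c) / s′ ⊖ I) ((J * s′ + c) % s′)
      ≡⟨ cong₂ (λ J′ c′ → block I r (J′ ⊖ I) c′)
          ([m*n+o]/n≡m J s′ c c<s′) ([m*n+o]%n≡o J s′ c c<s′) ⟩
    block I r (J ⊖ I) c
      ≡⟨ cong (λ δ′ → block I r δ′ c) ([I+δ]⊖I≡δ I δ (ℕ.<⇒≤ I<q) δ<q) ⟩
    block I r δ c ∎
    where
    open ≡-Reasoning
    J : ℕ
    J = (I + δ) % q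

  source-surjective : ∀ a {π} → π < q → ∃[ I ] (I < q × source I a ≡ π)
  source-surjective 0             {π} π<q = π , π<q , refl
  source-surjective 1             {π} π<q = π , π<q , refl
  source-surjective (suc (suc _)) {π} π<q =
    π ⊖ 2 , m%n<n (π + (q ∸ 2)) q , [J⊖δ+δ]%q≡J π 2 π<q (ℕ.≤-trans (s≤s (s≤s z≤n)) 4≤q)

  labelIndex-surjective : ∀ {z} → z < T * R →
    ∃[ π ] ∃[ u ] ∃[ r ] ∃[ c ] ((π < q × u < D × r < k′ × c < s′) × labelIndex π u r c ≡ z)
  labelIndex-surjective {z} z<TR = π , u , r , c , (π<q , m%n<n z₂ D , m%n<n z₁ k′ , m%n<n z s′) , packed
    where
    open ≡-Reasoning
    z₁ z₂ π u r c : ℕ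
    z₁ = z / s′
    z₂ = z₁ / k′
    π = z₂ / D
    u = z₂ % D
    r = z₁ % k′
    c = z % s′
    π<q : π < q
    π<q = m<n*o⇒m/o<n (m<n*o⇒m/o<n (m<n*o⇒m/o<n (subst (z <_) (sym qDk′s′≡TR) z<TR)))
    recombine : ∀ w n .{{_ : NonZero n}} → w / n * n + w % n ≡ w
    recombine w n = trans (ℕ.+-comm (w / n * n) (w % n)) (sym (m≡m%n+[m/n]*n w n))
    packed : labelIndex π u r c ≡ z
    packed = begin
      ((π * D + u) * k′ + r) * s′ + c   ≡⟨ cong (λ w → (w * k′ + r) * s′ + c) (recombine z₂ D) ⟩
      (z₂ * k′ + r) * s′ + c            ≡⟨ cong (λ w → w * s′ + c) (recombine z₁ k′) ⟩
      z₁ * s′ + c                       ≡⟨ recombine z s′ ⟩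
      z                                 ∎

  magnitude-decompose : ∀ {y} → y < H → ¬ R₁ ∣ y →
    ∃[ a ] ∃[ z ] (a < 4 × z < T * R × a * Δ + nthNonMultiple z ≡ y)
  magnitude-decompose {y} y<H R₁∤y with y % R₁ in y%R₁≡
  ... | zero  = contradiction (m%n≡0⇒n∣m y R₁ y%R₁≡) R₁∤y
  ... | suc ρ = a , z , a<4 , m*o+p<n*o (m%n<n w T) ρ<R , recompose
    where
    open ≡-Reasoning
    w a z : ℕ
    w = y / R₁
    a = w / T
    z = w % T * R + ρ
    ρ<R : ρ < R
    ρ<R = ℕ.≤-pred (subst (_< R₁) y%R₁≡ (m%n<n y R₁))
    a<4 : a < 4
    a<4 = m<n*o⇒m/o<n (m<n*o⇒m/o<n (subst (y <_) (sym (ℕ.*-assoc 4 T R₁)) y<H))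
    regroup : ∀ a T R₁ b c → a * (T * R₁) + (b * R₁ + c) ≡ (b + a * T) * R₁ + c
    regroup = ℕ-solve-∀
    recompose : a * Δ + nthNonMultiple z ≡ y
    recompose = begin
      a * Δ + (z / R * R₁ + suc (z % R))
        ≡⟨ cong₂ (λ b c → a * Δ + (b * R₁ + suc c)) ([m*n+o]/n≡m (w % T) R ρ ρ<R)
            ([m*n+o]%n≡o (w % T) R ρ ρ<R) ⟩
      a * Δ + (w % T * R₁ + suc ρ)
        ≡⟨ regroup a T R₁ (w % T) (suc ρ) ⟩
      (w % T + a * T) * R₁ + suc ρ
        ≡⟨ cong (λ n → n * R₁ + suc ρ) (sym (m≡m%n+[m/n]*n w T)) ⟩
      w * R₁ + suc ρ
        ≡⟨ cong (_+_ (w * R₁)) (sym y%R₁≡) ⟩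
      w * R₁ + y % R₁
        ≡⟨ ℕ.+-comm (w * R₁) (y % R₁) ⟩
      y % R₁ + w * R₁
        ≡⟨ sym (m≡m%n+[m/n]*n y R₁) ⟩
      y ∎

  A : PFArray (q * k′) (q * s′)
  A i j = cell (toℕ i) (toℕ j)

  Occurs : ℕ → Set
  Occurs y = ∃[ i ] ∃[ j ] ∃[ e ] (A i j ≡ just e × (e ≡ + y ⊎ e ≡ - (+ y)))

  occurs : ∀ {y} → y < H → ¬ R₁ ∣ y → Occurs y
  occurs y<H R₁∤y with magnitude-decompose y<H R₁∤y
  ... | a , z , a<4 , z<TR , refl with labelIndex-surjective z<TR
  ... | π , u , r , c , (π<q , u<D , r<k′ , c<s′) , refl with source-surjective a π<q
  ... | I , I<q , refl = fromℕ< x<qk′ , fromℕ< y<qs′ , quadEntry I r u a c , located , sign-± a _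
    where
    open ≡-Reasoning
    δ : ℕ
    δ = u * 4 + a
    δ<g : δ < g
    δ<g = m*o+p<n*o u<D a<4
    x<qk′ : I * k′ + r < q * k′
    x<qk′ = m*o+p<n*o I<q r<k′
    y<qs′ : (I + δ) % q * s′ + c < q * s′
    y<qs′ = m*o+p<n*o (m%n<n (I + δ) q) c<s′
    located : A (fromℕ< x<qk′) (fromℕ< y<qs′) ≡ just (quadEntry I r u a c)
    located = begin
      cell (toℕ (fromℕ< x<qk′)) (toℕ (fromℕ< y<qs′))
        ≡⟨ cong₂ cell (toℕ-fromℕ< x<qk′) (toℕ-fromℕ< y<qs′) ⟩
      cell (I * k′ + r) ((I + δ) % q * s′ + c)
        ≡⟨ cell-at I<q r<k′ (ℕ.<-≤-trans δ<g 4D≤q) c<s′ ⟩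
      block I r δ c
        ≡⟨ block-filled δ<g ⟩
      just (entry I r δ c)
        ≡⟨ cong just (entry-quad I r u a c a<4) ⟩
      just (quadEntry I r u a c) ∎

  v : ℕ
  v = 2 * (q * k′) * (g * s′) + T * 8

  v≡H+H : v ≡ H + H
  v≡H+H = begin
    2 * (q * k′) * (D * 4 * s′) + T * 8   ≡⟨ cong (λ n → n + T * 8) (regroup q D k′ s′) ⟩
    q * D * k′ * s′ * 8 + T * 8          ≡⟨ cong (λ n → n * 8 + T * 8) qDk′s′≡TR ⟩
    T * R * 8 + T * 8                    ≡⟨ expand T R ⟩
    H + H                                ∎
    where
    open ≡-Reasoning
    regroup : ∀ q D k′ s′ → 2 * (q * k′) * (D * 4 * s′) ≡ q * D * k′ * s′ * 8
    regroup = ℕ-solve-∀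
    expand : ∀ T R → T * R * 8 + T * 8 ≡ 4 * (T * suc R) + 4 * (T * suc R)
    expand = ℕ-solve-∀

  v/2≡H : v / 2 ≡ H
  v/2≡H = trans (cong (_/ 2) (trans v≡H+H (double H))) (m*n/n≡m H 2)
    where
    double : ∀ H → H + H ≡ H * 2
    double = ℕ-solve-∀

  R₁∣H : R₁ ∣ H
  R₁∣H = divides (4 * T) (sym (ℕ.*-assoc 4 T R₁))

  R₁∣⇒InJ : ∀ {x} → R₁ ∣ x → InJ v (T * 8) x
  R₁∣⇒InJ (divides j refl) = divides j (trans (regroup T j R) (cong (j *_) (sym v≡H+H)))
    where
    regroup : ∀ T j R → T * 8 * (j * suc R) ≡ j * (4 * (T * suc R) + 4 * (T * suc R))
    regroup = ℕ-solve-∀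

  appears : ∀ {x y} → (+ y) ≡ + x [mod v ] ⊎ (+ y) ≡ - (+ x) [mod v ] → Occurs y → AppearsPM v A x
  appears y≡±x (i , j , e , Aij≡e , e≡±y) = i , j , e , Aij≡e , ±≡±[mod] e≡±y y≡±x

  covers : ∀ x → x < v → ¬ InJ v (T * 8) x → AppearsPM v A x
  covers x x<v x∉J with ℕ.<-cmp x H
  ... | tri< x<H _ _  = appears (inj₁ (≡[mod]-refl v (+ x))) (occurs x<H (x∉J ∘ R₁∣⇒InJ))
  ... | tri≈ _ refl _ = contradiction (R₁∣⇒InJ R₁∣H) x∉J
  ... | tri> _ _ H<x  = appears (inj₂ (v∸x≡-x[mod] (ℕ.<⇒≤ x<v))) (occurs v∸x<H R₁∤v∸x)
    where
    v∸x<H : v ∸ x < H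
    v∸x<H = subst (v ∸ x <_) (trans (cong (_∸ H) v≡H+H) (ℕ.m+n∸n≡m H H)) (ℕ.∸-monoʳ-< H<x (ℕ.<⇒≤ x<v))
    R₁∤v∸x : ¬ R₁ ∣ v ∸ x
    R₁∤v∸x R₁∣v∸x = x∉J (R₁∣⇒InJ (∣m+n∣m⇒∣n (subst (R₁ ∣_) (sym (ℕ.m∸n+n≡m (ℕ.<⇒≤ x<v))) R₁∣v) R₁∣v∸x))
      where
      R₁∣v : R₁ ∣ v
      R₁∣v = subst (R₁ ∣_) (sym v≡H+H) (∣m∣n⇒∣m+n R₁∣H R₁∣H)

  rowCount≡ : ∀ i → rowCount A i ≡ g * s′
  rowCount≡ i = ℤ.+-injective (begin
    + rowCount A i
      ≡⟨ +sum≡sumℤ (λ j → filled (A i j)) (allFin (q * s′)) ⟩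
    sumℤ (map (λ j → + filled (A i j)) (allFin _))
      ≡⟨ sumℤ-allFin (q * s′) (λ y → + filled (cell (toℕ i) y)) ⟩
    sumBelow (q * s′) (λ y → + filled (cell (toℕ i) y))
      ≡⟨ sumBelow-row (λ e → + filled e) refl (toℕ i) ⟩
    sumBelow g (λ _ → sumBelow s′ (λ _ → + 1))
      ≡⟨ sumBelow-ones g s′ ⟩
    + (g * s′) ∎)
    where open ≡-Reasoning

  colCount≡ : ∀ j → colCount A j ≡ g * k′
  colCount≡ j = ℤ.+-injective (begin
    + colCount A j
      ≡⟨ +sum≡sumℤ (λ i → filled (A i j)) (allFin (q * k′)) ⟩
    sumℤ (map (λ i → + filled (A i j)) (allFin _))
      ≡⟨ sumℤ-allFin (q * k′) (λ x → + filled (cell x (toℕ j))) ⟩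
    sumBelow (q * k′) (λ x → + filled (cell x (toℕ j)))
      ≡⟨ sumBelow-column (λ e → + filled e) refl (toℕ j) (toℕ<n j) ⟩
    sumBelow g (λ _ → sumBelow k′ (λ _ → + 1))
      ≡⟨ sumBelow-ones g k′ ⟩
    + (g * k′) ∎)
    where open ≡-Reasoning

  rowSum≡0 : ∀ i → rowSum A i ≡ + 0
  rowSum≡0 i = trans (sumℤ-allFin (q * s′) (λ y → value (cell (toℕ i) y)))
                     (trans (sumBelow-row value refl (toℕ i)) (row-cancels _ _))

  colSum≡0 : ∀ j → colSum A j ≡ + 0
  colSum≡0 j = trans (sumℤ-allFin (q * k′) (λ x → value (cell x (toℕ j))))
                     (trans (sumBelow-column value refl (toℕ j) (toℕ<n j)) (column-cancels _ _))

  heffter : ∀ {m n s k t} → m ≡ q * k′ → n ≡ q * s′ → s ≡ g * s′ → k ≡ g * k′ → t ≡ T * 8 →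
            ∃[ A ] IntegerHeffter m n s k t A
  heffter refl refl refl refl refl = A , record
    { entriesRep   = λ i j e Aij≡e → map₂ (λ ∣e∣<H → subst (ℤ.∣ e ∣ ≤_) (sym v/2≡H) (ℕ.<⇒≤ ∣e∣<H))
                                          (cell-bounds (toℕ<n i) (toℕ<n j) Aij≡e)
    ; rowFill      = rowCount≡
    ; colFill      = colCount≡
    ; covers       = covers
    ; rowSum≡0modv = λ i → subst (_≡ + 0 [mod v ]) (sym (rowSum≡0 i)) (≡[mod]-refl v (+ 0))
    ; colSum≡0modv = λ j → subst (_≡ + 0 [mod v ]) (sym (colSum≡0 j)) (≡[mod]-refl v (+ 0))
    ; rowSumInt≡0  = rowSum≡0
    ; colSumInt≡0  = colSum≡0
    }

coprime-quotient : ∀ {m n a b} .{{_ : NonZero b}} → Coprime a b → m * a ≡ n * b →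
  ∃[ q ] (m ≡ q * b × n ≡ q * a)
coprime-quotient {m} {n} {a} {b} a⊥b ma≡nb
  with coprime-divisor (Coprime.sym a⊥b) (divides n (trans (ℕ.*-comm a m) ma≡nb))
... | divides q refl = q , refl , ℕ.*-cancelʳ-≡ n (q * a) b (trans (sym ma≡nb) (right-comm q b a))
  where
  right-comm : ∀ q b a → q * b * a ≡ q * a * b
  right-comm = ℕ-solve-∀

coprime-factorisation : ∀ {m n s′ k′} g .{{_ : NonZero g}} .{{_ : NonZero s′}} .{{_ : NonZero k′}} →
  Coprime s′ k′ → s′ * g ≤ n → m * (s′ * g) ≡ n * (k′ * g) → ∃[ q ] (m ≡ q * k′ × n ≡ q * s′ × g ≤ q)
coprime-factorisation {m} {n} {s′} {k′} g s′⊥k′ s′g≤n ms′g≡nk′g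
  with coprime-quotient {m} {n} s′⊥k′ (ℕ.*-cancelʳ-≡ (m * s′) (n * k′) g
         (trans (ℕ.*-assoc m s′ g) (trans ms′g≡nk′g (sym (ℕ.*-assoc n k′ g)))))
... | q , refl , refl = q , refl , refl , ℕ.*-cancelʳ-≤ g q s′ (subst (_≤ q * s′) (ℕ.*-comm s′ g) s′g≤n)

record BlockShape (m n s k t : ℕ) : Set where
  field
    q k′ s′ D T R : ℕ
    k′≢0 : NonZero k′
    s′≢0 : NonZero s′
    D≢0  : NonZero D
    T≢0  : NonZero T
    R≢0  : NonZero R
    4D≤q : D * 4 ≤ q
    qDk′s′≡TR : q * D * k′ * s′ ≡ T * R
    m≡qk′ : m ≡ q * k′
    n≡qs′ : n ≡ q * s′
    s≡D4s′ : s ≡ D * 4 * s′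
    k≡D4k′ : k ≡ D * 4 * k′
    t≡T8 : t ≡ T * 8

blockShape : ∀ {m n s k t} → 4 ≤ s → s ≤ n → 4 ≤ k → k ≤ m → m * s ≡ n * k →
             4 ∣ s → 4 ∣ k → t ∣ 2 * m * s → 8 ∣ t → BlockShape m n s k t
blockShape {m} {n} {s} {k} {t} 4≤s s≤n 4≤k k≤m ms≡nk 4∣s 4∣k t∣2ms 8∣t
  with gcd-greatest 4∣s 4∣k | 8∣t | t∣2ms
... | divides D g≡D*4 | divides T refl | divides R 2ms≡R*t = record
  { q = q ; k′ = k′ ; s′ = s′ ; D = D ; T = T ; R = R
  ; k′≢0 = k′≢0 ; s′≢0 = s′≢0
  ; D≢0 = ℕ.m*n≢0⇒m≢0 D {{subst NonZero g≡D*4 g≢0}}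
  ; T≢0 = ℕ.m*n≢0⇒m≢0 T {{ℕ.m*n≢0⇒n≢0 R {{Rt≢0}}}}
  ; R≢0 = ℕ.m*n≢0⇒m≢0 R {{Rt≢0}}
  ; 4D≤q = subst (_≤ q) g≡D*4 g≤q
  ; qDk′s′≡TR = ℕ.*-cancelʳ-≡ _ _ 8 (trans (regroup q D k′ s′)
                  (trans (cong₂ (λ m s → 2 * m * s) (sym m≡qk′) (sym s≡D4s′)) (trans 2ms≡R*t (reorder R T))))
  ; m≡qk′ = m≡qk′ ; n≡qs′ = n≡qs′ ; s≡D4s′ = s≡D4s′
  ; k≡D4k′ = trans k≡k′g (trans (ℕ.*-comm k′ g) (cong (_* k′) g≡D*4))
  ; t≡T8 = refl
  }
  where
  nonZero : ∀ {a} → 4 ≤ a → NonZero a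
  nonZero 4≤a = ℕ.>-nonZero (ℕ.<-≤-trans (s≤s z≤n) 4≤a)
  instance
    s≢0 : NonZero s
    s≢0 = nonZero 4≤s
    k≢0 : NonZero k
    k≢0 = nonZero 4≤k
    m≢0 : NonZero m
    m≢0 = nonZero (ℕ.≤-trans 4≤k k≤m)
  g : ℕ
  g = gcd s k
  instance
    g≢0 : NonZero g
    g≢0 = ℕ.≢-nonZero (ℕ.≢-nonZero⁻¹ s ∘ gcd[m,n]≡0⇒m≡0)
  Rt≢0 : NonZero (R * (T * 8))
  Rt≢0 = subst NonZero 2ms≡R*t (ℕ.m*n≢0 (2 * m) s {{ℕ.m*n≢0 2 m}})
  s′ k′ : ℕ
  s′ = s / g
  k′ = k / g
  instance
    k′≢0 : NonZero k′
    k′≢0 = ℕ.≢-nonZero (n/gcd[m,n]≢0 s k)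
    s′≢0 : NonZero s′
    s′≢0 = ℕ.≢-nonZero (m/gcd[m,n]≢0 s k)
  s≡s′g : s ≡ s′ * g
  s≡s′g = sym (m/n*n≡m (gcd[m,n]∣m s k))
  k≡k′g : k ≡ k′ * g
  k≡k′g = sym (m/n*n≡m (gcd[m,n]∣n s k))
  s≡D4s′ : s ≡ D * 4 * s′
  s≡D4s′ = trans s≡s′g (trans (ℕ.*-comm s′ g) (cong (_* s′) g≡D*4))
  factorisation : ∃[ q ] (m ≡ q * k′ × n ≡ q * s′ × g ≤ q)
  factorisation = coprime-factorisation g (coprime-/gcd s k) (subst (_≤ n) s≡s′g s≤n)
                    (subst₂ (λ a b → m * a ≡ n * b) s≡s′g k≡k′g ms≡nk)
  q : ℕ
  q = proj₁ factorisation
  m≡qk′ : m ≡ q * k′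
  m≡qk′ = proj₁ (proj₂ factorisation)
  n≡qs′ : n ≡ q * s′
  n≡qs′ = proj₁ (proj₂ (proj₂ factorisation))
  g≤q : g ≤ q
  g≤q = proj₂ (proj₂ (proj₂ factorisation))
  regroup : ∀ q D k′ s′ → q * D * k′ * s′ * 8 ≡ 2 * (q * k′) * (D * 4 * s′)
  regroup = ℕ-solve-∀
  reorder : ∀ R T → R * (T * 8) ≡ T * R * 8
  reorder = ℕ-solve-∀

lemma3p2 : (m n s k : ℕ) → 4 ≤ s → s ≤ n → 4 ≤ k → k ≤ m → m * s ≡ n * k →
           4 ∣ s → 4 ∣ k → (t : ℕ) → t ∣ 2 * m * s → 8 ∣ t →
           ∃ λ (A : PFArray m n) → IntegerHeffter m n s k t A
lemma3p2 m n s k 4≤s s≤n 4≤k k≤m ms≡nk 4∣s 4∣k t t∣2ms 8∣t =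
  Construction.heffter q k′ s′ D T R {{k′≢0}} {{s′≢0}} {{D≢0}} {{T≢0}} {{R≢0}} 4D≤q qDk′s′≡TR
                       m≡qk′ n≡qs′ s≡D4s′ k≡D4k′ t≡T8
  where
  open BlockShape (blockShape 4≤s s≤n 4≤k k≤m ms≡nk 4∣s 4∣k t∣2ms 8∣t)
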